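{- For every letter $n>0$, the word $\alpha(0n0)=\alpha(0)\alpha(n)\alpha(0)$ is square-free.
   Context: All words are over $\mathbb{N}=\{0,1,2,\dots\}$; letters are written as numerals (e.g. $202101$ has letters $2,0,2,1,0,1$). Positions are indexed from $0$; $w[i:j]=w[i]\cdots w[j-1]$, $w[:j]=w[0:j]$, negative indices count from the end ($w[:-k]$ deletes the last $k$ letters, $w[-k:]$ is the suffix of length $k$). For nonempty finite $w$, $w^+$ is $w$ with its last letter increased by $1$. A square is a nonempty word $yy$; square-free means no square factor. The ruler morphism is $\rho(n)=0\,(n+1)$ and $R_n=\rho^n(0)$ (prefix of length $2^n$ of $0102010301020104\cdots$). Define $P_0(n)=R_{n+1}[:-2]$. Define the morphism $\psi_1$ by $\psi_1(0)=202101$, $\psi_1(n)=(n+1)P_0(n+1)$ for $n\ge1$; $P_1(n)=\psi_1(P_0(n-1))$. Define the morphism $\psi_2$ by $\psi_2(n)=(n+2)P_0(n+2)P_1(n+2)$ for $n\ge1$ and $\psi_2(0)$ equal to the 199-letter word 2021020102101201020120210120102013010201030102012021012010201 2021013010201030102012021012010201202301020103010201202101201 0201203010201030102030103020102030102010301020301030201202101 2010201202101202 (concatenate the pieces). Let $C=0102030102$, $B_0=0301\,\psi_1(1010)[:-3]\,\psi_2(1010)[:-6]\,\psi_2(10)[:-12]\,301020$, $B_1=\rho(B_0[7:-5])$, $E=0102\,B_0\,1\,B_0[:-9]$, $F=B_0[-9:]\,3010302\,C\,0103\,C^+\,02$. The morphism $\alpha$ is defined by $\alpha(0)=EFE$,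 $\alpha(1)=B_1R_4CB_1R_4$, and $\alpha(n)=\alpha(n-1)^+R_{n+3}C\alpha(n-1)^+R_{n+3}$ for $n\ge2$. -}

module Defs where

open import Data.Nat using (ℕ; zero; suc; _+_; _∸_)
open import Data.List using (List; []; _∷_; _++_; length; take; drop; concatMap)
open import Relation.Binary.PropositionalEquality using (_≡_)

Word : Set
Word = List ℕ

applyM : (ℕ → Word) → Word → Word
applyM f w = concatMap f w

-- w⁺ : last letter increased by 1 (identity on the empty word, never used there)
incLast : Word → Word
incLast []           = []
incLast (x ∷ [])     = suc x ∷ []
incLast (x ∷ y ∷ ws) = x ∷ incLast (y ∷ ws)

dropLast : ℕ → Word → Word
dropLast k w = take (length w ∸ k) w

lastN : ℕ → Word → Word
lastN k w = drop (length w ∸ k) w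

ρ : ℕ → Word
ρ n = 0 ∷ suc n ∷ []

R : ℕ → Word
R zero    = 0 ∷ []
R (suc n) = applyM ρ (R n)

P₀ : ℕ → Word
P₀ n = dropLast 2 (R (n + 1))

ψ₁ : ℕ → Word
ψ₁ zero    = 2 ∷ 0 ∷ 2 ∷ 1 ∷ 0 ∷ 1 ∷ []
ψ₁ (suc m) = (suc m + 1) ∷ P₀ (suc m + 1)

-- P₁(n) = ψ₁(P₀(n-1))  (only used for n ≥ 2)
P₁ : ℕ → Word
P₁ n = applyM ψ₁ (P₀ (n ∸ 1))

ψ₂0 : Word
ψ₂0 = 2 ∷ 0 ∷ 2 ∷ 1 ∷ 0 ∷ 2 ∷ 0 ∷ 1 ∷ 0 ∷ 2 ∷ 1 ∷ 0 ∷ 1 ∷ 2 ∷ 0 ∷ 1 ∷ 0 ∷ 2 ∷ 0 ∷ 1 ∷ 2 ∷ 0 ∷ 2 ∷ 1 ∷ 0 ∷ 1 ∷ 2 ∷ 0 ∷ 1 ∷ 0 ∷ 2 ∷ 0 ∷ 1 ∷ 3 ∷ 0 ∷ 1 ∷ 0 ∷ 2 ∷ 0 ∷ 1 ∷ 0 ∷ 3 ∷ 0 ∷ 1 ∷ 0 ∷ 2 ∷ 0 ∷ 1 ∷ 2 ∷ 0 ∷ 2 ∷ 1 ∷ 0 ∷ 1 ∷ 2 ∷ 0 ∷ 1 ∷ 0 ∷ 2 ∷ 0 ∷ 1 ∷ 2 ∷ 0 ∷ 2 ∷ 1 ∷ 0 ∷ 1 ∷ 3 ∷ 0 ∷ 1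 ∷ 0 ∷ 2 ∷ 0 ∷ 1 ∷ 0 ∷ 3 ∷ 0 ∷ 1 ∷ 0 ∷ 2 ∷ 0 ∷ 1 ∷ 2 ∷ 0 ∷ 2 ∷ 1 ∷ 0 ∷ 1 ∷ 2 ∷ 0 ∷ 1 ∷ 0 ∷ 2 ∷ 0 ∷ 1 ∷ 2 ∷ 0 ∷ 2 ∷ 3 ∷ 0 ∷ 1 ∷ 0 ∷ 2 ∷ 0 ∷ 1 ∷ 0 ∷ 3 ∷ 0 ∷ 1 ∷ 0 ∷ 2 ∷ 0 ∷ 1 ∷ 2 ∷ 0 ∷ 2 ∷ 1 ∷ 0 ∷ 1 ∷ 2 ∷ 0 ∷ 1 ∷ 0 ∷ 2 ∷ 0 ∷ 1 ∷ 2 ∷ 0 ∷ 3 ∷ 0 ∷ 1 ∷ 0 ∷ 2 ∷ 0 ∷ 1 ∷ 0 ∷ 3 ∷ 0 ∷ 1 ∷ 0 ∷ 2 ∷ 0 ∷ 3 ∷ 0 ∷ 1 ∷ 0 ∷ 3 ∷ 0 ∷ 2 ∷ 0 ∷ 1 ∷ 0 ∷ 2 ∷ 0 ∷ 3 ∷ 0 ∷ 1 ∷ 0 ∷ 2 ∷ 0 ∷ 1 ∷ 0 ∷ 3 ∷ 0 ∷ 1 ∷ 0 ∷ 2 ∷ 0 ∷ 3 ∷ 0 ∷ 1 ∷ 0 ∷ 3 ∷ 0 ∷ 2 ∷ 0 ∷ 1 ∷ 2 ∷ 0 ∷ 2 ∷ 1 ∷ 0 ∷ 1 ∷ 2 ∷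 0 ∷ 1 ∷ 0 ∷ 2 ∷ 0 ∷ 1 ∷ 2 ∷ 0 ∷ 2 ∷ 1 ∷ 0 ∷ 1 ∷ 2 ∷ 0 ∷ 2 ∷ []

ψ₂ : ℕ → Word
ψ₂ zero    = ψ₂0
ψ₂ (suc m) = (suc m + 2) ∷ (P₀ (suc m + 2) ++ P₁ (suc m + 2))

C : Word
C = 0 ∷ 1 ∷ 0 ∷ 2 ∷ 0 ∷ 3 ∷ 0 ∷ 1 ∷ 0 ∷ 2 ∷ []

B₀ : Word
B₀ = (0 ∷ 3 ∷ 0 ∷ 1 ∷ [])
  ++ dropLast 3 (applyM ψ₁ (1 ∷ 0 ∷ 1 ∷ 0 ∷ []))
  ++ dropLast 6 (applyM ψ₂ (1 ∷ 0 ∷ 1 ∷ 0 ∷ []))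
  ++ dropLast 12 (applyM ψ₂ (1 ∷ 0 ∷ []))
  ++ (3 ∷ 0 ∷ 1 ∷ 0 ∷ 2 ∷ 0 ∷ [])

B₁ : Word
B₁ = applyM ρ (drop 7 (dropLast 5 B₀))

E : Word
E = (0 ∷ 1 ∷ 0 ∷ 2 ∷ []) ++ B₀ ++ (1 ∷ []) ++ dropLast 9 B₀

F : Word
F = lastN 9 B₀ ++ (3 ∷ 0 ∷ 1 ∷ 0 ∷ 3 ∷ 0 ∷ 2 ∷ []) ++ C
  ++ (0 ∷ 1 ∷ 0 ∷ 3 ∷ []) ++ incLast C ++ (0 ∷ 2 ∷ [])

α : ℕ → Word
α zero          = E ++ F ++ E
α (suc zero)    = B₁ ++ R 4 ++ C ++ B₁ ++ R 4
α (suc (suc m)) = incLast (α (suc m)) ++ R (suc (suc m) + 3) ++ C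
                  ++ incLast (α (suc m)) ++ R (suc (suc m) + 3)

SquareFree : Word → Set
SquareFree w = ∀ (u y v : Word) → w ≡ u ++ y ++ y ++ v → y ≡ []

{-# OPTIONS --safe #-}
module Submission where

-- Write α(k+1) = aₖ ℓ, where ℓ = k+4 is its largest letter.  With the fresh letter
-- M = k+5 and the Zimin word Z = R_M[:-1] of rank M, the definition unfolds to
-- α(k+2) = aₖ M Z M C aₖ M Z M.  A word X M Y with X square-free and free of M and
-- Y square-free can only contain a square through the displayed M, and such a
-- square is governed by the blocks between consecutive M's.  In α(0) α(k+2) α(0)
-- and in C aₖ₊₁ the possible block configurations are few, and each of them forces
-- a clash between known ends of the blocks: aₖ and Z share a long suffix but
-- disagree on the letter before it, C and Z part after 01020, C and α(0) after
-- 01020301, and α(0) ends in 12.  So square-freeness of α(0) α(k+1) α(0) and of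
-- C aₖ propagates from k to k+1, and the case k = 0 is a certified computation.

open import Defs
open import Data.Bool using (Bool; true; T; _∧_)
open import Data.Bool.Properties using (T-∧)
open import Data.Empty using (⊥-elim)
open import Data.List
  using (List; []; _∷_; _++_; _∷ʳ_; _ʳ++_; length; reverse; foldr; take; drop)
open import Data.List.Properties
  using (++-assoc; ++-identityʳ; ++-cancelˡ; ++-cancelʳ; ∷-injective; ∷-injectiveˡ;
         ∷-injectiveʳ; ∷ʳ-injective; ∷ʳ-++; ++-ʳ++; ʳ++-defn; reverse-involutive;
         length-reverse; length-++; foldr-∷ʳ; concatMap-++; ++-monoid)
open import Data.List.Relation.Unary.All using (All; []; _∷_; all?)
import Data.List.Relation.Unary.All as All
open import Data.List.Relation.Unary.All.Properties using (++⁺; ++⁻ˡ; ++⁻ʳ)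
open import Data.Nat
  using (ℕ; zero; suc; _+_; _≤_; _<_; z≤n; s≤s; _≟_; _≤?_; _<ᵇ_; _≤ᵇ_)
open import Data.Nat.Properties
  using (<ᵇ⇒<; ≤ᵇ⇒≤; <-irrefl; ≤-refl; ≤-trans; ≤-<-trans; <⇒≢; <⇒≤; m≤n⇒m≤1+n; m≤n+m; 1+n≢0;
         +-suc; +-identityʳ; +-mono-≤; module ≤-Reasoning)
open import Data.Product using (∃; _×_; _,_; proj₁; proj₂)
open import Data.Sum using (_⊎_; inj₁; inj₂)
open import Function using (_∘_)
open import Function.Bundles using (Equivalence)
open import Relation.Binary.PropositionalEquality
open import Relation.Nullary using (¬_; yes; no)
open import Relation.Nullary.Decidable using (toWitness)
open import Tactic.MonoidSolver using (solve)

++-≡-++ : ∀ {A : Set} (a b c d : List A) → a ++ b ≡ c ++ d →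
          (∃ λ t → c ≡ a ++ t × b ≡ t ++ d) ⊎ (∃ λ t → a ≡ c ++ t × d ≡ t ++ b)
++-≡-++ []      b c       d eq = inj₁ (c , refl , eq)
++-≡-++ (x ∷ a) b []      d eq = inj₂ (x ∷ a , refl , sym eq)
++-≡-++ (x ∷ a) b (y ∷ c) d eq with ∷-injective eq
... | refl , eq′ with ++-≡-++ a b c d eq′
...   | inj₁ (t , c≡ , b≡) = inj₁ (t , cong (x ∷_) c≡ , b≡)
...   | inj₂ (t , a≡ , d≡) = inj₂ (t , cong (x ∷_) a≡ , d≡)

++-∷-cancelʳ : ∀ {A : Set} (u w s : List A) {x y} → u ++ x ∷ s ≡ w ++ y ∷ s → u ≡ w × x ≡ y
++-∷-cancelʳ u w s {x} {y} eq =
  ∷ʳ-injective u w (++-cancelʳ s (u ∷ʳ x) (w ∷ʳ y)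
    (trans (∷ʳ-++ u x s) (trans eq (sym (∷ʳ-++ w y s)))))

squareFree-++⁻ˡ : ∀ x y → SquareFree (x ++ y) → SquareFree x
squareFree-++⁻ˡ _ y sf u z v refl = sf u z (v ++ y) (solve (++-monoid ℕ))

squareFree-++⁻ʳ : ∀ x y → SquareFree (x ++ y) → SquareFree y
squareFree-++⁻ʳ x _ sf u z v refl = sf (x ++ u) z v (sym (++-assoc x u _))

squareFree-length≤1 : ∀ {w} → length w ≤ 1 → SquareFree w
squareFree-length≤1 _ u []      v _    = refl
squareFree-length≤1 h u (c ∷ y) v refl = ⊥-elim (<-irrefl refl (≤-trans (2≤ u y) h))
  where
  2≤ : ∀ u y → 2 ≤ length (u ++ c ∷ y ++ c ∷ y ++ v)
  2≤ []      []      = s≤s (s≤s z≤n)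
  2≤ []      (_ ∷ _) = s≤s (s≤s z≤n)
  2≤ (_ ∷ u) y       = m≤n⇒m≤1+n (2≤ u y)

Avoids : ℕ → Word → Set
Avoids M = All (_≢ M)

¬avoids-++-∷ : ∀ {M} u v → ¬ Avoids M (u ++ M ∷ v)
¬avoids-++-∷ u v av = All.head (++⁻ʳ u av) refl

avoids-suffix : ∀ {M W} u y → W ≡ u ++ y → Avoids M W → Avoids M y
avoids-suffix u y refl av = ++⁻ʳ u av

avoids-ʳ++ : ∀ {M} xs {ys} → Avoids M xs → Avoids M ys → Avoids M (xs ʳ++ ys)
avoids-ʳ++ []       _           avys = avys
avoids-ʳ++ (x ∷ xs) (x≢ ∷ avxs) avys = avoids-ʳ++ xs avxs (x≢ ∷ avys)

<⇒avoids : ∀ {M w} → All (_< M) w → Avoids M w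
<⇒avoids = All.map <⇒≢

≤⇒avoids : ∀ {b M w} → All (_≤ b) w → b < M → Avoids M w
≤⇒avoids w≤b b<M = All.map (λ x≤b → <⇒≢ (≤-<-trans x≤b b<M)) w≤b

avoids-separator : ∀ {M} a b {s t} → Avoids M a → Avoids M b →
                   a ++ M ∷ s ≡ b ++ M ∷ t → a ≡ b × s ≡ t
avoids-separator []      []      _          _          eq = refl , ∷-injectiveʳ eq
avoids-separator []      (_ ∷ _) _          (x≢M ∷ _)  eq = ⊥-elim (x≢M (sym (∷-injectiveˡ eq)))
avoids-separator (_ ∷ _) []      (x≢M ∷ _)  _          eq = ⊥-elim (x≢M (∷-injectiveˡ eq))
avoids-separator (x ∷ a) (y ∷ b) (_ ∷ ava)  (_ ∷ avb)  eq with ∷-injective eq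
... | refl , eq′ with avoids-separator a b ava avb eq′
...   | refl , s≡t = refl , s≡t

first-separator : ∀ {M B y₁} y₂ {T Z} → Avoids M B → Avoids M y₁ →
                  y₂ ++ y₁ ++ M ∷ T ≡ B ++ M ∷ Z →
                  (y₂ ++ y₁ ≡ B × T ≡ Z) ⊎ (∃ λ y₂′ → y₂ ≡ B ++ M ∷ y₂′ × Z ≡ y₂′ ++ y₁ ++ M ∷ T)
first-separator {M} {B} {y₁} y₂ {T} {Z} avB avy₁ eq with ++-≡-++ y₂ (y₁ ++ M ∷ T) B (M ∷ Z) eq
... | inj₁ (t , B≡ , rest) with avoids-separator y₁ t avy₁ (avoids-suffix y₂ t B≡ avB) rest
...   | refl , T≡Z = inj₁ (sym B≡ , T≡Z)
first-separator y₂ avB avy₁ eq | inj₂ ([] , y₂≡ , rest)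
  with avoids-separator [] _ [] avy₁ rest
... | refl , Z≡T = inj₁ (trans (++-identityʳ y₂) (trans y₂≡ (++-identityʳ _)) , sym Z≡T)
first-separator y₂ avB avy₁ eq | inj₂ (_ ∷ t , y₂≡ , rest) with ∷-injective rest
... | refl , Z≡ = inj₂ (t , y₂≡ , Z≡)

-- Squares through a separator letter

blocks : ℕ → List Word → Word → Word
blocks M Bs t = foldr (λ B s → B ++ M ∷ s) t Bs

-- A square (y₁ M blocks M Bs y₂)² in X M (blocks M Bs Z) with y₁ a suffix of X.
data CrossSquare (M : ℕ) (X : Word) (Bs : List Word) (Z : Word) : Set where
  cross : ∀ x y₁ y₂ v → X ≡ x ++ y₁ → Z ≡ y₂ ++ y₁ ++ M ∷ blocks M Bs (y₂ ++ v) →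
          CrossSquare M X Bs Z

-- The square of a CrossSquare M U Bs (V ++ M ∷ W) whose second M is the one after V.
data Bridge (M : ℕ) (Bs : List Word) (U V W : Word) : Set where
  bridge : ∀ u y₁ y₂ v → U ≡ u ++ y₁ → V ≡ y₂ ++ y₁ → W ≡ blocks M Bs (y₂ ++ v) →
           Bridge M Bs U V W

squareFree-insert : ∀ {M X Z} → Avoids M X → SquareFree X → SquareFree Z →
                    ¬ CrossSquare M X [] Z → SquareFree (X ++ M ∷ Z)
squareFree-insert _ _ _ _ _ [] _ _ = refl
squareFree-insert {M} {X} {Z} avX sfX sfZ noCross u y@(_ ∷ y′) v eq
  with ++-≡-++ X (M ∷ Z) u (y ++ y ++ v) eq
... | inj₁ (t , _ , Z≡) = startsInZ t Z≡
  where
  startsInZ : ∀ t → M ∷ Z ≡ t ++ y ++ y ++ v → y ≡ []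
  startsInZ []      Z≡ with ∷-injective Z≡
  ... | refl , Z≡′ = ⊥-elim (noCross (cross X [] y′ v (sym (++-identityʳ X)) Z≡′))
  startsInZ (_ ∷ t) Z≡ = sfZ t y v (∷-injectiveʳ Z≡)
... | inj₂ (t , X≡ , yyv≡) = startsInX (avoids-suffix u t X≡ avX) yyv≡
  where
  startsInX : Avoids M t → y ++ y ++ v ≡ t ++ M ∷ Z → y ≡ []
  startsInX avt yyv≡ with ++-≡-++ y (y ++ v) t (M ∷ Z) yyv≡
  ... | inj₁ (s , refl , yv≡) with ++-≡-++ y v s (M ∷ Z) yv≡
  ...   | inj₁ (r , refl , _) = sfX u y r (trans X≡ (cong (u ++_) (solve (++-monoid ℕ))))
  ...   | inj₂ ([] , y≡ , _) = sfX u y [] (trans X≡ (cong (λ w → u ++ y ++ w)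
          (trans (sym (++-identityʳ s)) (trans (sym y≡) (sym (++-identityʳ y))))))
  ...   | inj₂ (_ ∷ r , y≡ , Mv≡) with ∷-injective Mv≡
  ...     | refl , _ = ⊥-elim (¬avoids-++-∷ s r (subst (Avoids M) y≡ (++⁻ˡ y avt)))
  startsInX avt yyv≡ | inj₂ ([] , y≡ , Mv≡) with ∷-injective Mv≡
  ... | refl , _ =
    ⊥-elim (All.head (subst (Avoids M) (trans (sym (++-identityʳ t)) (sym y≡)) avt) refl)
  startsInX avt yyv≡ | inj₂ (_ ∷ s , y≡ , Mv≡) with ∷-injective Mv≡
  ... | refl , Z≡ = ⊥-elim (noCross (cross u t s v X≡
    (trans Z≡ (trans (cong (λ w → s ++ w ++ v) y≡) (cong (s ++_) (++-assoc t _ v))))))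

¬crossSquare-avoids : ∀ {M X Bs Z} → Avoids M Z → ¬ CrossSquare M X Bs Z
¬crossSquare-avoids avZ (cross _ y₁ y₂ _ _ Z≡) = ¬avoids-++-∷ y₁ _ (avoids-suffix y₂ _ Z≡ avZ)

-- Either the second M of the square is the one after B (a bridge over B), or B M has
-- to be repeated after the second M.
¬crossSquare-∷ : ∀ {M X B Bs Z} → Avoids M X → Avoids M B → ¬ Bridge M Bs X B Z →
                 ¬ CrossSquare M X (Bs ∷ʳ B) Z → ¬ CrossSquare M X Bs (B ++ M ∷ Z)
¬crossSquare-∷ {M} {X} {B} {Bs} avX avB ¬bridge noCross (cross x y₁ y₂ v X≡ eq)
  with first-separator y₂ avB (avoids-suffix x y₁ X≡ avX) (sym eq)
... | inj₁ (B≡ , Z≡) = ¬bridge (bridge x y₁ y₂ v X≡ (sym B≡) (sym Z≡))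
... | inj₂ (y₂′ , refl , Z≡) = noCross (cross x y₁ y₂′ v X≡
  (trans Z≡ (cong (λ w → y₂′ ++ y₁ ++ M ∷ w)
    (trans (cong (blocks M Bs) (++-assoc B (M ∷ y₂′) v))
           (sym (foldr-∷ʳ (λ B s → B ++ M ∷ s) (y₂′ ++ v) B Bs))))))

bridge-∷⁻ : ∀ {M B Bs U V W} → Bridge M (B ∷ Bs) U V (B ++ M ∷ W) → Bridge M Bs U V W
bridge-∷⁻ {B = B} (bridge u y₁ y₂ v U≡ V≡ W≡) =
  bridge u y₁ y₂ v U≡ V≡ (∷-injectiveʳ (++-cancelˡ B _ _ W≡))

¬bridge-avoids : ∀ {M B Bs U V W} → Avoids M W → ¬ Bridge M (B ∷ Bs) U V W
¬bridge-avoids {M} {B} avW (bridge _ _ _ _ _ _ W≡) =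
  ¬avoids-++-∷ B _ (subst (Avoids M) W≡ avW)

common-prefix-mismatch : ∀ (c y₂ : Word) {y₁ v x x′ r r′} → x ≢ x′ →
                         c ++ x ∷ r ≡ y₂ ++ y₁ → c ++ x′ ∷ r′ ≡ y₂ ++ v → ∃ λ d → y₁ ≡ d ++ x ∷ r
common-prefix-mismatch c       []       _    e _  = c , sym e
common-prefix-mismatch []      (_ ∷ _)  x≢x′ e e′ =
  ⊥-elim (x≢x′ (trans (∷-injectiveˡ e) (sym (∷-injectiveˡ e′))))
common-prefix-mismatch (_ ∷ c) (_ ∷ y₂) x≢x′ e e′ =
  common-prefix-mismatch c y₂ x≢x′ (∷-injectiveʳ e) (∷-injectiveʳ e′)

bridge-mismatch : ∀ {M U} (c : Word) {x x′ r r′} → x ≢ x′ →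
                  Bridge M [] U (c ++ x ∷ r) (c ++ x′ ∷ r′) → ∃ λ u → U ≡ u ++ x ∷ r
bridge-mismatch c x≢x′ (bridge u y₁ y₂ v U≡ V≡ W≡)
  with d , refl ← common-prefix-mismatch c y₂ x≢x′ V≡ W≡
  = u ++ d , trans U≡ (sym (++-assoc u d _))

-- A certified square-freeness checker

lcp : Word → Word → ℕ
lcp (x ∷ xs) (y ∷ ys) with x ≟ y
... | yes _ = suc (lcp xs ys)
... | no _  = 0
lcp _ _ = 0

lcp-++ : ∀ y a b → length y ≤ lcp (y ++ a) (y ++ b)
lcp-++ []      a b = z≤n
lcp-++ (x ∷ y) a b with x ≟ x
... | yes _  = s≤s (lcp-++ y a b)
... | no x≢x = ⊥-elim (x≢x refl)

lcp-ʳ++ : ∀ y a b → length y ≤ lcp (y ʳ++ a) (y ʳ++ b)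
lcp-ʳ++ y a b rewrite ʳ++-defn y {a} | ʳ++-defn y {b} =
  subst (_≤ lcp (reverse y ++ a) (reverse y ++ b)) (length-reverse y) (lcp-++ (reverse y) a b)

-- crossFreeᵇ M rX Z rp d w, for Z = p ++ w with rp = reverse p and d = length p: at every
-- M of w, a cross square (y₁ M y₂)² of reverse rX M Z would make lcp Z (y₂ v) ≥ |y₂| and
-- lcp rX (reverse (y₂ y₁)) ≥ |y₁|, so these two lengths must add up to less than |y₂ y₁|.
crossFreeᵇ : ℕ → Word → Word → Word → ℕ → Word → Bool
crossFreeᵇ M rX Z rp d []      = true
crossFreeᵇ M rX Z rp d (c ∷ w) with c ≟ M
... | yes _ = (lcp Z w + lcp rX rp <ᵇ d) ∧ crossFreeᵇ M rX Z (c ∷ rp) (suc d) w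
... | no _  = crossFreeᵇ M rX Z (c ∷ rp) (suc d) w

crossFreeᵇ-sound : ∀ M rX Z rp p w → T (crossFreeᵇ M rX Z rp (length rp) (p ++ M ∷ w)) →
                   lcp Z w + lcp rX (p ʳ++ rp) < length rp + length p
crossFreeᵇ-sound M rX Z rp [] w h with M ≟ M
... | yes _  = subst (lcp Z w + lcp rX rp <_) (sym (+-identityʳ _))
                 (<ᵇ⇒< _ _ (proj₁ (Equivalence.to T-∧ h)))
... | no M≢M = ⊥-elim (M≢M refl)
crossFreeᵇ-sound M rX Z rp (c ∷ p) w h with c ≟ M
... | yes _ = subst (lcp Z w + lcp rX (p ʳ++ c ∷ rp) <_) (sym (+-suc _ _))
                (crossFreeᵇ-sound M rX Z (c ∷ rp) p w (proj₂ (Equivalence.to T-∧ h)))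
... | no _  = subst (lcp Z w + lcp rX (p ʳ++ c ∷ rp) <_) (sym (+-suc _ _))
                (crossFreeᵇ-sound M rX Z (c ∷ rp) p w h)

crossFreeᵇ⇒¬crossSquare : ∀ M rX Z → T (crossFreeᵇ M rX Z [] 0 Z) →
                          ¬ CrossSquare M (reverse rX) [] Z
crossFreeᵇ⇒¬crossSquare M rX Z h (cross x y₁ y₂ v X≡ Z≡) = <-irrefl refl (begin-strict
    length (y₂ ++ y₁)                               ≡⟨ length-++ y₂ ⟩
    length y₂ + length y₁                           ≤⟨ +-mono-≤ lcp₁ lcp₂ ⟩
    lcp Z (y₂ ++ v) + lcp rX ((y₂ ++ y₁) ʳ++ [])    <⟨ lcp< ⟩
    length (y₂ ++ y₁)                               ∎)
  where
  open ≤-Reasoning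
  lcp< : lcp Z (y₂ ++ v) + lcp rX ((y₂ ++ y₁) ʳ++ []) < length (y₂ ++ y₁)
  lcp< = crossFreeᵇ-sound M rX Z [] (y₂ ++ y₁) (y₂ ++ v)
           (subst (λ w → T (crossFreeᵇ M rX Z [] 0 w)) (trans Z≡ (sym (++-assoc y₂ y₁ _))) h)
  lcp₁ : length y₂ ≤ lcp Z (y₂ ++ v)
  lcp₁ = subst (λ z → length y₂ ≤ lcp z (y₂ ++ v)) (sym Z≡) (lcp-++ y₂ _ v)
  rX≡ : rX ≡ y₁ ʳ++ reverse x
  rX≡ = trans (sym (reverse-involutive rX)) (trans (cong reverse X≡) (++-ʳ++ x))
  lcp₂ : length y₁ ≤ lcp rX ((y₂ ++ y₁) ʳ++ [])
  lcp₂ = subst₂ (λ a b → length y₁ ≤ lcp a b) (sym rX≡) (sym (++-ʳ++ y₂))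
           (lcp-ʳ++ y₁ (reverse x) (reverse y₂))

-- squareFreeᵇ m w cuts w at its occurrences of m, checks the blocks in between over the
-- letters below m and the squares through each cut with crossFreeᵇ; it is exact on
-- words over {0, …, m}.
squareFreeᵇ : ℕ → Word → Bool
blocksSquareFreeᵇ : ℕ → Word → Word → Bool

squareFreeᵇ zero    w = length w ≤ᵇ 1
squareFreeᵇ (suc m) w = blocksSquareFreeᵇ m [] w

blocksSquareFreeᵇ m rX []      = squareFreeᵇ m (reverse rX)
blocksSquareFreeᵇ m rX (c ∷ Z) with c ≟ suc m
... | yes _ = squareFreeᵇ m (reverse rX) ∧ crossFreeᵇ (suc m) rX Z [] 0 Z
              ∧ blocksSquareFreeᵇ m [] Z
... | no _  = blocksSquareFreeᵇ m (c ∷ rX) Z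

squareFreeᵇ-sound : ∀ m w → T (squareFreeᵇ m w) → SquareFree w
blocksSquareFreeᵇ-sound : ∀ m rX w → T (blocksSquareFreeᵇ m rX w) → Avoids (suc m) rX →
                          SquareFree (rX ʳ++ w)

squareFreeᵇ-sound zero    w h = squareFree-length≤1 (≤ᵇ⇒≤ _ _ h)
squareFreeᵇ-sound (suc m) w h = blocksSquareFreeᵇ-sound m [] w h []

blocksSquareFreeᵇ-sound m rX []      h _ = squareFreeᵇ-sound m _ h
blocksSquareFreeᵇ-sound m rX (c ∷ Z) h avX with c ≟ suc m
... | yes refl =
  let sfX , rest = Equivalence.to T-∧ h
      crossFree , sfZ = Equivalence.to T-∧ rest
  in subst SquareFree (sym (ʳ++-defn rX))
       (squareFree-insert (avoids-ʳ++ rX avX []) (squareFreeᵇ-sound m _ sfX)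
          (blocksSquareFreeᵇ-sound m [] Z sfZ [])
          (crossFreeᵇ⇒¬crossSquare (suc m) rX Z crossFree))
... | no c≢ = blocksSquareFreeᵇ-sound m (c ∷ rX) Z h (c≢ ∷ avX)

-- Zimin words

zimin : ℕ → Word
zimin zero    = []
zimin (suc k) = zimin k ++ k ∷ zimin k

ρ-zimin : ∀ k → applyM ρ (zimin k) ∷ʳ 0 ≡ zimin (suc k)
ρ-zimin zero    = refl
ρ-zimin (suc k) = begin
    applyM ρ (zimin k ++ k ∷ zimin k) ∷ʳ 0
  ≡⟨ cong (_∷ʳ 0) (concatMap-++ ρ (zimin k) (k ∷ zimin k)) ⟩
    (applyM ρ (zimin k) ++ 0 ∷ suc k ∷ applyM ρ (zimin k)) ∷ʳ 0
  ≡⟨ reassoc (applyM ρ (zimin k)) (0 ∷ []) (suc k ∷ []) ⟩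
    (applyM ρ (zimin k) ∷ʳ 0) ++ suc k ∷ (applyM ρ (zimin k) ∷ʳ 0)
  ≡⟨ cong (λ z → z ++ suc k ∷ z) (ρ-zimin k) ⟩
    zimin (suc (suc k))
  ∎
  where
  open ≡-Reasoning
  reassoc : ∀ (w o s : Word) → (w ++ o ++ s ++ w) ++ o ≡ (w ++ o) ++ s ++ (w ++ o)
  reassoc w o s = solve (++-monoid ℕ)

R≡zimin∷ʳ : ∀ k → R k ≡ zimin k ∷ʳ k
R≡zimin∷ʳ zero    = refl
R≡zimin∷ʳ (suc k) = begin
    applyM ρ (R k)
  ≡⟨ cong (applyM ρ) (R≡zimin∷ʳ k) ⟩
    applyM ρ (zimin k ∷ʳ k)
  ≡⟨ concatMap-++ ρ (zimin k) (k ∷ []) ⟩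
    applyM ρ (zimin k) ++ 0 ∷ suc k ∷ []
  ≡⟨ sym (++-assoc (applyM ρ (zimin k)) (0 ∷ []) (suc k ∷ [])) ⟩
    (applyM ρ (zimin k) ∷ʳ 0) ∷ʳ suc k
  ≡⟨ cong (_∷ʳ suc k) (ρ-zimin k) ⟩
    zimin (suc k) ∷ʳ suc k
  ∎
  where open ≡-Reasoning

zimin-< : ∀ k → All (_< k) (zimin k)
zimin-< zero    = []
zimin-< (suc k) = ++⁺ (All.map m≤n⇒m≤1+n (zimin-< k)) (≤-refl ∷ All.map m≤n⇒m≤1+n (zimin-< k))

zimin-squareFree : ∀ k → SquareFree (zimin k)
zimin-squareFree zero    = squareFree-length≤1 z≤n
zimin-squareFree (suc k) = squareFree-insert avZ sfZ sfZ (¬crossSquare-avoids avZ)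
  where
  avZ : Avoids k (zimin k)
  avZ = <⇒avoids (zimin-< k)
  sfZ : SquareFree (zimin k)
  sfZ = zimin-squareFree k

ℓ : ℕ → ℕ
ℓ k = suc k + 3

extend : ℕ → Word → Word
extend M a = a ++ M ∷ zimin M ++ M ∷ C ++ a ++ M ∷ zimin M

incLast-∷ʳ : ∀ w x → incLast (w ∷ʳ x) ≡ w ∷ʳ suc x
incLast-∷ʳ []          x = refl
incLast-∷ʳ (_ ∷ [])    x = refl
incLast-∷ʳ (y ∷ z ∷ w) x = cong (y ∷_) (incLast-∷ʳ (z ∷ w) x)

α-unfold : ∀ k {a} → α (suc k) ≡ a ∷ʳ ℓ k → α (suc (suc k)) ≡ extend (ℓ (suc k)) a ∷ʳ ℓ (suc k)
α-unfold k {a} α≡ rewrite α≡ | incLast-∷ʳ a (ℓ k) | R≡zimin∷ʳ (ℓ (suc k)) =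
  reassoc a (zimin (ℓ (suc k))) C (ℓ (suc k) ∷ [])
  where
  reassoc : ∀ (a z c m : Word) →
            (a ++ m) ++ (z ++ m) ++ c ++ (a ++ m) ++ (z ++ m) ≡
            (a ++ m ++ z ++ m ++ c ++ a ++ m ++ z) ++ m
  reassoc a z c m = solve (++-monoid ℕ)

extend-≤ : ∀ {k a} → All (_≤ ℓ k) a → All (_≤ ℓ (suc k)) (extend (ℓ (suc k)) a)
extend-≤ {k} {a} a≤ = ++⁺ a≤′ (≤-refl ∷ ++⁺ Z≤ (≤-refl ∷ ++⁺ C≤ (++⁺ a≤′ (≤-refl ∷ Z≤))))
  where
  a≤′ : All (_≤ ℓ (suc k)) a
  a≤′ = All.map m≤n⇒m≤1+n a≤
  Z≤ : All (_≤ ℓ (suc k)) (zimin (ℓ (suc k)))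
  Z≤ = All.map <⇒≤ (zimin-< (ℓ (suc k)))
  C≤ : All (_≤ ℓ (suc k)) C
  C≤ = All.map (λ x≤3 → ≤-trans x≤3 (m≤n+m 3 (suc (suc k))))
         (toWitness {a? = all? (_≤? 3) C} _)

squareFree-frame⁻ : ∀ A a x → SquareFree (A ++ (a ∷ʳ x) ++ A) → SquareFree (A ++ a) × SquareFree A
squareFree-frame⁻ A a x sf =
  squareFree-++⁻ˡ (A ++ a) (x ∷ A)
    (subst SquareFree (trans (cong (A ++_) (++-assoc a _ A)) (sym (++-assoc A a _))) sf) ,
  squareFree-++⁻ʳ (A ++ (a ∷ʳ x)) A (subst SquareFree (sym (++-assoc A _ A)) sf)

module InductionStep {M : ℕ} {A Aᵗ Aʹ a X S : Word} {p : ℕ}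
  (A≡ : A ≡ 0 ∷ 1 ∷ 0 ∷ 2 ∷ 0 ∷ 3 ∷ 0 ∷ 1 ∷ 2 ∷ Aᵗ)
  (A≡′ : A ≡ Aʹ ++ 1 ∷ 2 ∷ [])
  (a≡ : a ≡ X ++ p ∷ S) (p≢1 : p ≢ 1)
  (zimin≡ : zimin M ≡ 0 ∷ 1 ∷ 0 ∷ 2 ∷ 0 ∷ 1 ∷ S)
  (avA : Avoids M A) (ava : Avoids M a) (avC : Avoids M C)
  where

  Z : Word
  Z = zimin M

  avZ : Avoids M Z
  avZ = <⇒avoids (zimin-< M)

  avAa : Avoids M (A ++ a)
  avAa = ++⁺ avA ava

  avCa : Avoids M (C ++ a)
  avCa = ++⁺ avC ava

  sfZ : SquareFree Z
  sfZ = zimin-squareFree M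

  letter-before-S : ∀ T u {q} → T ++ a ≡ u ++ q ∷ S → q ≡ p
  letter-before-S T u Ta≡ = sym (proj₂ (++-∷-cancelʳ (T ++ X) u S
    (trans (sym (trans (cong (T ++_) a≡) (sym (++-assoc T X (p ∷ S))))) Ta≡)))

  ¬bridge-Z : ∀ T {r W} → W ≡ 0 ∷ 1 ∷ 0 ∷ 2 ∷ 0 ∷ 3 ∷ r → ¬ Bridge M [] (T ++ a) Z W
  ¬bridge-Z T refl b
    with u , Ta≡ ← bridge-mismatch (0 ∷ 1 ∷ 0 ∷ 2 ∷ 0 ∷ []) (λ ())
                     (subst (λ V → Bridge M [] (T ++ a) V _) zimin≡ b)
    = p≢1 (sym (letter-before-S T u Ta≡))

  ¬bridge-Ca : ∀ {r W} → W ≡ 0 ∷ 1 ∷ 0 ∷ 2 ∷ 0 ∷ 1 ∷ r → ¬ Bridge M [] Z (C ++ a) W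
  ¬bridge-Ca refl b
    with u , Z≡ ← bridge-mismatch (0 ∷ 1 ∷ 0 ∷ 2 ∷ 0 ∷ []) (λ ()) b
    = p≢1 (sym (letter-before-S (u ++ 3 ∷ 0 ∷ 1 ∷ 0 ∷ 2 ∷ []) (0 ∷ 1 ∷ 0 ∷ 2 ∷ 0 ∷ [])
                  (trans (++-assoc u _ a) (trans (sym Z≡) zimin≡))))

  ¬bridge-A : ¬ Bridge M [] (A ++ a) (C ++ a) A
  ¬bridge-A b
    with u , Aa≡ ← bridge-mismatch (0 ∷ 1 ∷ 0 ∷ 2 ∷ 0 ∷ 3 ∷ 0 ∷ 1 ∷ []) (λ ())
                     (subst (Bridge M [] (A ++ a) (C ++ a)) A≡ b)
    = 1+n≢0 (proj₂ (++-∷-cancelʳ Aʹ u (2 ∷ []) (trans (sym A≡′) A≡u02)))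
    where
    A≡u02 : A ≡ u ++ 0 ∷ 2 ∷ []
    A≡u02 = ++-cancelʳ a A (u ++ 0 ∷ 2 ∷ []) (trans Aa≡ (sym (++-assoc u (0 ∷ 2 ∷ []) a)))

  squareFree-framed : SquareFree (A ++ a) → SquareFree (C ++ a) → SquareFree A →
                      SquareFree (A ++ (extend M a ∷ʳ M) ++ A)
  squareFree-framed sfAa sfCa sfA = subst SquareFree (sym (reassoc A a Z C (M ∷ [])))
    (squareFree-insert avAa sfAa
      (squareFree-insert avZ sfZ
        (squareFree-insert avCa sfCa
          (squareFree-insert avZ sfZ sfA (¬crossSquare-avoids avA))
          noCross-Ca)
        noCross-Z)
      noCross-Aa)
    where
    reassoc : ∀ (A a z c m : Word) →
              A ++ ((a ++ m ++ z ++ m ++ c ++ a ++ m ++ z) ++ m) ++ A ≡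
              (A ++ a) ++ m ++ z ++ m ++ (c ++ a) ++ m ++ z ++ m ++ A
    reassoc A a z c m = solve (++-monoid ℕ)
    noCross-Ca : ¬ CrossSquare M (C ++ a) [] (Z ++ M ∷ A)
    noCross-Ca = ¬crossSquare-∷ avCa avZ (¬bridge-Z C A≡) (¬crossSquare-avoids avA)
    noCross-Z : ¬ CrossSquare M Z [] ((C ++ a) ++ M ∷ Z ++ M ∷ A)
    noCross-Z = ¬crossSquare-∷ avZ avCa (¬bridge-Ca (cong (_++ M ∷ A) zimin≡))
                  (¬crossSquare-∷ avZ avZ (¬bridge-avoids avA) (¬crossSquare-avoids avA))
    noCross-Aa : ¬ CrossSquare M (A ++ a) [] (Z ++ M ∷ (C ++ a) ++ M ∷ Z ++ M ∷ A)
    noCross-Aa = ¬crossSquare-∷ avAa avZ (¬bridge-Z A refl)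
                   (¬crossSquare-∷ avAa avCa (¬bridge-A ∘ bridge-∷⁻)
                     (¬crossSquare-∷ avAa avZ (¬bridge-avoids avA) (¬crossSquare-avoids avA)))

  squareFree-C-extend : SquareFree (C ++ a) → SquareFree (C ++ extend M a)
  squareFree-C-extend sfCa = subst SquareFree (sym (reassoc C a Z (M ∷ [])))
    (squareFree-insert avCa sfCa
      (squareFree-insert avZ sfZ
        (squareFree-insert avCa sfCa sfZ (¬crossSquare-avoids avZ))
        noCross-Z)
      noCross-Ca)
    where
    reassoc : ∀ (c a z m : Word) →
              c ++ a ++ m ++ z ++ m ++ c ++ a ++ m ++ z ≡
              (c ++ a) ++ m ++ z ++ m ++ (c ++ a) ++ m ++ z
    reassoc c a z m = solve (++-monoid ℕ)
    noCross-Z : ¬ CrossSquare M Z [] ((C ++ a) ++ M ∷ Z)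
    noCross-Z = ¬crossSquare-∷ avZ avCa (¬bridge-Ca zimin≡) (¬crossSquare-avoids avZ)
    noCross-Ca : ¬ CrossSquare M (C ++ a) [] (Z ++ M ∷ (C ++ a) ++ M ∷ Z)
    noCross-Ca = ¬crossSquare-∷ avCa avZ (¬bridge-Z C refl)
                   (¬crossSquare-∷ avCa avCa (¬bridge-avoids avZ) (¬crossSquare-avoids avZ))

  extend≡ : extend M a ≡ (a ++ M ∷ Z ++ M ∷ C ++ X) ++ p ∷ (S ++ M ∷ Z)
  extend≡ = trans (cong (λ b → a ++ M ∷ Z ++ M ∷ C ++ b ++ M ∷ Z) a≡)
                  (reassoc a Z C (M ∷ []) X (p ∷ []) S)
    where
    reassoc : ∀ (a z c m X q S : Word) →
              a ++ m ++ z ++ m ++ c ++ (X ++ q ++ S) ++ m ++ z ≡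
              (a ++ m ++ z ++ m ++ c ++ X) ++ q ++ (S ++ m ++ z)
    reassoc a z c m X q S = solve (++-monoid ℕ)

α0-prefix : α 0 ≡ 0 ∷ 1 ∷ 0 ∷ 2 ∷ 0 ∷ 3 ∷ 0 ∷ 1 ∷ 2 ∷ drop 9 (α 0)
α0-prefix = refl

α0-suffix : α 0 ≡ take 3224 (α 0) ++ 1 ∷ 2 ∷ []
α0-suffix = refl

record Invariant (k : ℕ) : Set where
  field
    body              : Word
    α≡                : α (suc k) ≡ body ∷ʳ ℓ k
    body≤             : All (_≤ ℓ k) body
    framed-squareFree : SquareFree (α 0 ++ α (suc k) ++ α 0)
    C-body-squareFree : SquareFree (C ++ body)
    X S               : Word
    p                 : ℕ
    body≡             : body ≡ X ++ p ∷ S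
    p≢1               : p ≢ 1
    zimin≡            : zimin (suc (ℓ k)) ≡ 0 ∷ 1 ∷ 0 ∷ 2 ∷ 0 ∷ 1 ∷ S

invariant-0 : Invariant 0
invariant-0 = record
  { body              = take 3185 (α 1)
  ; α≡                = refl
  ; body≤             = toWitness {a? = all? (_≤? 4) (take 3185 (α 1))} _
  ; framed-squareFree = squareFreeᵇ-sound 4 _ _
  ; C-body-squareFree = squareFreeᵇ-sound 4 _ _
  ; X                 = take 3159 (α 1)
  ; S                 = drop 6 (zimin 5)
  ; p                 = 2
  ; body≡             = refl
  ; p≢1               = λ ()
  ; zimin≡            = refl
  }

invariant-suc : ∀ {k} → Invariant k → Invariant (suc k)
invariant-suc {k} I = record
  { body              = extend M body
  ; α≡                = α-unfold k α≡
  ; body≤             = extend-≤ body≤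
  ; framed-squareFree = subst (λ w → SquareFree (α 0 ++ w ++ α 0)) (sym (α-unfold k α≡))
                          (squareFree-framed (proj₁ sf-frame) C-body-squareFree (proj₂ sf-frame))
  ; C-body-squareFree = squareFree-C-extend C-body-squareFree
  ; X                 = body ++ M ∷ zimin M ++ M ∷ C ++ X
  ; S                 = S ++ M ∷ zimin M
  ; p                 = p
  ; body≡             = extend≡
  ; p≢1               = p≢1
  ; zimin≡            = cong (_++ M ∷ zimin M) zimin≡
  }
  where
  open Invariant I
  M : ℕ
  M = ℓ (suc k)
  3<M : 3 < M
  3<M = s≤s (m≤n⇒m≤1+n (m≤n+m 3 k))
  open InductionStep {Aʹ = take 3224 (α 0)} α0-prefix α0-suffix body≡ p≢1 zimin≡
         (≤⇒avoids (toWitness {a? = all? (_≤? 3) (α 0)} _) 3<M)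
         (≤⇒avoids body≤ ≤-refl)
         (≤⇒avoids (toWitness {a? = all? (_≤? 3) C} _) 3<M)
  sf-frame : SquareFree (α 0 ++ body) × SquareFree (α 0)
  sf-frame = squareFree-frame⁻ (α 0) body (ℓ k)
               (subst (λ w → SquareFree (α 0 ++ w ++ α 0)) α≡ framed-squareFree)

invariant : ∀ k → Invariant k
invariant zero    = invariant-0
invariant (suc k) = invariant-suc (invariant k)

proposition4p8 : ∀ (n : ℕ) → 0 < n → SquareFree (applyM α (0 ∷ n ∷ 0 ∷ []))
proposition4p8 zero    ()
proposition4p8 (suc k) _ =
  subst SquareFree (cong (λ w → α 0 ++ α (suc k) ++ w) (sym (++-identityʳ (α 0))))
    (Invariant.framed-squareFree (invariant k))
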